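{- Let $a$ be a positive integer divisible by $6$. Then the circulant digraph $\mathrm{Cay}(\mathbb{Z}_{2a}; a, a+2, a+3)$ has no hamiltonian circuit.
   Context: For a natural number $n$, $\mathbb{Z}_n$ denotes the additive cyclic group of integers modulo $n$. For a set $A$ of integers, $\mathrm{Cay}(\mathbb{Z}_n; A)$ is the digraph with vertex set $\mathbb{Z}_n$ having an arc from $u$ to $u+c \pmod n$ for every $u\in\mathbb{Z}_n$ and every $c\in A$; we write $\mathrm{Cay}(\mathbb{Z}_n; c_1,c_2,c_3)$ for $\mathrm{Cay}(\mathbb{Z}_n;\{c_1,c_2,c_3\})$. A hamiltonian circuit is a directed cycle passing through every vertex exactly once. -}

module Defs where

open import Data.Nat using (ℕ; suc; _+_; _%_; NonZero)
open import Data.Fin using (Fin; toℕ; fromℕ<)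
open import Data.Nat.DivMod using (m%n<n)
open import Data.List using (List)
open import Data.List.Membership.Propositional using (_∈_)
open import Data.Product using (∃; _×_)
open import Function.Definitions using (Injective)
open import Relation.Binary.PropositionalEquality using (_≡_)

CayArc : (n : ℕ) → .{{_ : NonZero n}} → List ℕ → Fin n → Fin n → Set
CayArc n A u v = ∃ λ c → c ∈ A × toℕ v ≡ (toℕ u + c) % n

nextPos : (n : ℕ) → .{{_ : NonZero n}} → Fin n → Fin n
nextPos n i = fromℕ< (m%n<n (suc (toℕ i)) n)

-- A hamiltonian circuit in a digraph on Fin n: a cyclic ordering
-- v₀, v₁, …, v_{n-1} of the vertices, each vertex occurring exactly once
-- (injective on n positions, hence a bijection), with an arc from v_i to v_{i+1}
-- for every i (indices mod n, so the last vertex returns to v₀).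
HamiltonianCircuit : (n : ℕ) → .{{_ : NonZero n}} → (Fin n → Fin n → Set) → Set
HamiltonianCircuit n E =
  ∃ λ (v : Fin n → Fin n) → Injective _≡_ _≡_ v × (∀ i → E (v i) (v (nextPos n i)))

-- A hamiltonian circuit turns into its successor map σ x = x + a + d x with d x ∈ {0, 2, 3}, a
-- single cycle of even length N = 2a and therefore an odd permutation.  Every vertex is entered by
-- exactly one arc, so the number of arcs x → x + d x that jump over the gap between c + 2 and c + 3
-- does not depend on c.  If it is at most 1, then d vanishes at one of any two consecutive vertices;
-- as σ has no 2-cycle, d y = 0 forces d (y + a) ≠ 0 and from there d (y + 2) = 0, and walking from y
-- to y + a in steps of 2 contradicts this.  If it is 3, then d is constantly 3 and σ preserves
-- residues modulo 3 ∣ N.  If it is 2, then d is a sequence of blocks 2 and 3 3 0, so σ is translation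
-- by the even number a + 2 after a permutation of order 3, which makes σ even.

module Submission where

open import Defs
open import Data.Nat using (ℕ; _+_; _*_; NonZero)
open import Data.Nat.Divisibility using (_∣_)
open import Data.Nat.Properties using (m*n≢0)
open import Data.List using (_∷_; [])
open import Relation.Nullary using (¬_)

open import Data.Empty using (⊥; ⊥-elim)
open import Data.Fin.Base using (Fin; zero; suc; toℕ; fromℕ<; punchOut)
open import Data.Fin.Properties
  using (any?; _≟_; punchOut-injective; injective⇒≤; toℕ-injective; toℕ-fromℕ<; toℕ<n)
open import Data.List.Base using (List; _∷ʳ_; map; applyUpTo; upTo; lookup; length)
open import Data.List.Membership.Propositional using (_∈_)
open import Data.List.Membership.Propositional.Properties
  using (∈-applyUpTo⁺; ∈-applyUpTo⁻; ∈-upTo⁺; ∈-upTo⁻)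
open import Data.List.Membership.Propositional.Properties.WithK using (unique∧set⇒bag)
open import Data.List.Properties using (applyUpTo-∷ʳ; map-applyUpTo)
open import Data.List.Relation.Binary.BagAndSetEquality using (∼bag⇒↭)
open import Data.List.Relation.Binary.Permutation.Propositional as ↭ using (_↭_)
open import Data.List.Relation.Unary.All using (All; []; _∷_)
open import Data.List.Relation.Unary.AllPairs using (AllPairs; []; _∷_)
import Data.List.Relation.Unary.AllPairs.Properties as AllPairs
open import Data.List.Relation.Unary.Any using (index)
open import Data.List.Relation.Unary.Any.Properties using (lookup-index)
open import Data.Nat.Base using (zero; suc; _≤_; _<_; _%_; z≤n; s≤s; parity)
open import Data.Nat.DivMod
  using (_mod_; %-distribˡ-+; %-remove-+ʳ; m%n%n≡m%n; m%n<n; m<n⇒m%n≡m; m∣n⇒o%n%m≡o%m; n%n≡0;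
         [m+n]%n≡m%n; [m+kn]%n≡m%n)
open import Data.Nat.Divisibility using (divides; ∣-trans; ∣-refl; ∣⇒≤; ∣m∣n⇒∣m+n)
open import Data.Nat.Properties
  using (+-comm; +-assoc; +-suc; *-suc; +-identityʳ; +-mono-≤; ≤-trans; <-trans; ≤-reflexive;
         m≤m+n; n<1+n; 1+n≰n; <⇒≢)
open import Data.Nat.Tactic.RingSolver using (solve-∀)
open import Data.Parity.Base using (Parity; 0ℙ; 1ℙ; _⁻¹) renaming (_+_ to _⊕_; _*_ to _⊛_)
import Data.Parity.Properties as ℙ
open import Algebra.Properties.CommutativeSemigroup ℙ.+-commutativeSemigroup
  using (interchange; x∙yz≈y∙xz)
open import Data.Product.Base using (∃-syntax; _×_; _,_; proj₁; proj₂)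
open import Data.Sum.Base using (_⊎_; inj₁; inj₂)
open import Function.Base using (id; _∘_)
open import Function.Bundles using (mk⇔)
open import Function.Definitions using (Injective)
open import Relation.Nullary using (yes; no; contradiction)
open import Relation.Binary.PropositionalEquality
  using (_≡_; _≢_; refl; sym; trans; cong; cong₂; subst; module ≡-Reasoning)

infix 8 _>ₚ_

_>ₚ_ : ℕ → ℕ → Parity
zero  >ₚ _     = 0ℙ
suc x >ₚ zero  = 1ℙ
suc x >ₚ suc y = x >ₚ y

<⇒>ₚ≡0ℙ : ∀ {x y} → x < y → x >ₚ y ≡ 0ℙ
<⇒>ₚ≡0ℙ {zero}  _         = refl
<⇒>ₚ≡0ℙ {suc x} (s≤s x<y) = <⇒>ₚ≡0ℙ x<y

>ₚ-flip : ∀ {x y} → x ≢ y → y >ₚ x ≡ (x >ₚ y) ⁻¹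
>ₚ-flip {zero}  {zero}  x≢y = contradiction refl x≢y
>ₚ-flip {zero}  {suc y} _   = refl
>ₚ-flip {suc x} {zero}  _   = refl
>ₚ-flip {suc x} {suc y} x≢y = >ₚ-flip (x≢y ∘ cong suc)

below : ℕ → List ℕ → Parity
below x []       = 0ℙ
below x (y ∷ ys) = (x >ₚ y) ⊕ below x ys

above : ℕ → List ℕ → Parity
above x []       = 0ℙ
above x (y ∷ ys) = (y >ₚ x) ⊕ above x ys

inversions : List ℕ → Parity
inversions []       = 0ℙ
inversions (x ∷ xs) = below x xs ⊕ inversions xs

below-∷ʳ : ∀ x ys y → below x (ys ∷ʳ y) ≡ below x ys ⊕ (x >ₚ y)
below-∷ʳ x []       y = ℙ.+-comm (x >ₚ y) 0ℙ
below-∷ʳ x (z ∷ zs) y =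
  trans (cong ((x >ₚ z) ⊕_) (below-∷ʳ x zs y)) (sym (ℙ.+-assoc (x >ₚ z) (below x zs) (x >ₚ y)))

inversions-∷ʳ : ∀ xs x → inversions (xs ∷ʳ x) ≡ inversions xs ⊕ above x xs
inversions-∷ʳ []       x = refl
inversions-∷ʳ (y ∷ ys) x = begin
  below y (ys ∷ʳ x) ⊕ inversions (ys ∷ʳ x)
    ≡⟨ cong₂ _⊕_ (below-∷ʳ y ys x) (inversions-∷ʳ ys x) ⟩
  (below y ys ⊕ y >ₚ x) ⊕ (inversions ys ⊕ above x ys)
    ≡⟨ interchange (below y ys) (y >ₚ x) (inversions ys) (above x ys) ⟩
  (below y ys ⊕ inversions ys) ⊕ (y >ₚ x ⊕ above x ys) ∎
  where open ≡-Reasoning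

below-smallest : ∀ {x ys} → All (x <_) ys → below x ys ≡ 0ℙ
below-smallest []           = refl
below-smallest (x<y ∷ x<ys) = cong₂ _⊕_ (<⇒>ₚ≡0ℙ x<y) (below-smallest x<ys)

inversions-increasing : ∀ {xs} → AllPairs _<_ xs → inversions xs ≡ 0ℙ
inversions-increasing []            = refl
inversions-increasing (x<xs ∷ <-xs) = cong₂ _⊕_ (below-smallest x<xs) (inversions-increasing <-xs)

above-zero : ∀ f n → above 0 (applyUpTo (suc ∘ f) n) ≡ parity n
above-zero f zero    = refl
above-zero f (suc n) = trans (cong (1ℙ ⊕_) (above-zero (f ∘ suc) n)) (sym (ℙ.+-homo-+ 1 n))

discordant : (ℕ → ℕ) → ℕ → ℕ → Parity
discordant g x y = (x >ₚ y ⊛ g y >ₚ g x) ⊕ (y >ₚ x ⊛ g x >ₚ g y)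

discordant-sym : ∀ g x y → discordant g x y ≡ discordant g y x
discordant-sym g x y = ℙ.+-comm (x >ₚ y ⊛ g y >ₚ g x) (y >ₚ x ⊛ g x >ₚ g y)

>ₚ-relabel : ∀ g {x y} → g x ≢ g y → g x >ₚ g y ≡ x >ₚ y ⊕ discordant g x y
>ₚ-relabel g {x} {y} gx≢gy
  rewrite >ₚ-flip (gx≢gy ∘ cong g) | >ₚ-flip gx≢gy = q≡p⊕δ (x >ₚ y) (g x >ₚ g y)
  where
  q≡p⊕δ : ∀ p q → q ≡ p ⊕ ((p ⊛ q ⁻¹) ⊕ (p ⁻¹ ⊛ q))
  q≡p⊕δ 0ℙ q  = refl
  q≡p⊕δ 1ℙ 0ℙ = refl
  q≡p⊕δ 1ℙ 1ℙ = refl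

discordancesWith : (ℕ → ℕ) → ℕ → List ℕ → Parity
discordancesWith g x []       = 0ℙ
discordancesWith g x (y ∷ ys) = discordant g x y ⊕ discordancesWith g x ys

discordances : (ℕ → ℕ) → List ℕ → Parity
discordances g []       = 0ℙ
discordances g (x ∷ xs) = discordancesWith g x xs ⊕ discordances g xs

below-map : ∀ g {x ys} → All (λ y → g x ≢ g y) ys →
            below (g x) (map g ys) ≡ below x ys ⊕ discordancesWith g x ys
below-map g []                            = refl
below-map g {x} {y ∷ ys} (gx≢gy ∷ gx≢gys) = begin
  g x >ₚ g y ⊕ below (g x) (map g ys)
    ≡⟨ cong₂ _⊕_ (>ₚ-relabel g gx≢gy) (below-map g gx≢gys) ⟩
  (x >ₚ y ⊕ discordant g x y) ⊕ (below x ys ⊕ discordancesWith g x ys)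
    ≡⟨ interchange (x >ₚ y) (discordant g x y) (below x ys) (discordancesWith g x ys) ⟩
  (x >ₚ y ⊕ below x ys) ⊕ (discordant g x y ⊕ discordancesWith g x ys) ∎
  where open ≡-Reasoning

inversions-map : ∀ g {xs} → AllPairs (λ x y → g x ≢ g y) xs →
                 inversions (map g xs) ≡ inversions xs ⊕ discordances g xs
inversions-map g []                           = refl
inversions-map g {x ∷ xs} (gx≢gxs ∷ distinct) = begin
  below (g x) (map g xs) ⊕ inversions (map g xs)
    ≡⟨ cong₂ _⊕_ (below-map g gx≢gxs) (inversions-map g distinct) ⟩
  (below x xs ⊕ discordancesWith g x xs) ⊕ (inversions xs ⊕ discordances g xs)
    ≡⟨ interchange (below x xs) (discordancesWith g x xs) (inversions xs) (discordances g xs) ⟩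
  (below x xs ⊕ inversions xs) ⊕ (discordancesWith g x xs ⊕ discordances g xs) ∎
  where open ≡-Reasoning

discordancesWith-↭ : ∀ g x {xs ys} → xs ↭ ys →
                     discordancesWith g x xs ≡ discordancesWith g x ys
discordancesWith-↭ g x ↭.refl                   = refl
discordancesWith-↭ g x (↭.prep y p)             =
  cong (discordant g x y ⊕_) (discordancesWith-↭ g x p)
discordancesWith-↭ g x (↭.swap {xs} {ys} y z p) = begin
  discordant g x y ⊕ (discordant g x z ⊕ discordancesWith g x xs)
    ≡⟨ x∙yz≈y∙xz (discordant g x y) (discordant g x z) (discordancesWith g x xs) ⟩
  discordant g x z ⊕ (discordant g x y ⊕ discordancesWith g x xs)
    ≡⟨ cong (λ d → discordant g x z ⊕ (discordant g x y ⊕ d)) (discordancesWith-↭ g x p) ⟩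
  discordant g x z ⊕ (discordant g x y ⊕ discordancesWith g x ys) ∎
  where open ≡-Reasoning
discordancesWith-↭ g x (↭.trans p q)            =
  trans (discordancesWith-↭ g x p) (discordancesWith-↭ g x q)

discordances-↭ : ∀ g {xs ys} → xs ↭ ys → discordances g xs ≡ discordances g ys
discordances-↭ g ↭.refl                   = refl
discordances-↭ g (↭.prep x p)             =
  cong₂ _⊕_ (discordancesWith-↭ g x p) (discordances-↭ g p)
discordances-↭ g (↭.swap {xs} {ys} x y p) = begin
  (discordant g x y ⊕ discordancesWith g x xs) ⊕ (discordancesWith g y xs ⊕ discordances g xs)
    ≡⟨ interchange (discordant g x y) (discordancesWith g x xs) (discordancesWith g y xs) _ ⟩
  (discordant g x y ⊕ discordancesWith g y xs) ⊕ (discordancesWith g x xs ⊕ discordances g xs)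
    ≡⟨ cong₂ _⊕_ (cong₂ _⊕_ (discordant-sym g x y) (discordancesWith-↭ g y p))
                 (cong₂ _⊕_ (discordancesWith-↭ g x p) (discordances-↭ g p)) ⟩
  (discordant g y x ⊕ discordancesWith g y ys) ⊕ (discordancesWith g x ys ⊕ discordances g ys) ∎
  where open ≡-Reasoning
discordances-↭ g (↭.trans p q)            = trans (discordances-↭ g p) (discordances-↭ g q)

fin-injective⇒surjective : ∀ {m} (f : Fin m → Fin m) → Injective _≡_ _≡_ f →
                           ∀ y → ∃[ x ] f x ≡ y
fin-injective⇒surjective {suc m} f f-injective y with any? (λ x → f x ≟ y)
... | yes hit  = hit
... | no  miss = contradiction (injective⇒≤ g-injective) 1+n≰n
  where
  y≢f : ∀ x → y ≢ f x
  y≢f x y≡fx = miss (x , sym y≡fx)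
  g : Fin (suc m) → Fin m
  g x = punchOut (y≢f x)
  g-injective : Injective _≡_ _≡_ g
  g-injective {x} {z} gx≡gz = f-injective (punchOut-injective (y≢f x) (y≢f z) gx≡gz)

applyUpTo-cong : ∀ {f g : ℕ → ℕ} m → (∀ {x} → x < m → f x ≡ g x) →
                 applyUpTo f m ≡ applyUpTo g m
applyUpTo-cong zero    _   = refl
applyUpTo-cong (suc m) f≗g = cong₂ _∷_ (f≗g (s≤s z≤n)) (applyUpTo-cong m (f≗g ∘ s≤s))

module Residues (n : ℕ) where

  N : ℕ
  N = suc n

  infix 4 _≋_

  -- Being a plain definition, _≋_ unfolds during unification, so the implicit x and y of the lemmas
  -- below usually have to be given explicitly.
  _≋_ : ℕ → ℕ → Set
  x ≋ y = x % N ≡ y % N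

  %-≋ : ∀ x → x % N ≋ x
  %-≋ x = m%n%n≡m%n x N

  +N-≋ : ∀ x → x + N ≋ x
  +N-≋ x = [m+n]%n≡m%n x N

  suc[x+n]≋x : ∀ x → suc (x + n) ≋ x
  suc[x+n]≋x x = trans (cong (_% N) (sym (+-suc x n))) (+N-≋ x)

  +-congʳ-≋ : ∀ o {x y} → x ≋ y → x + o ≋ y + o
  +-congʳ-≋ o {x} {y} x≋y = begin
    (x + o) % N          ≡⟨ %-distribˡ-+ x o N ⟩
    (x % N + o % N) % N  ≡⟨ cong (λ r → (r + o % N) % N) x≋y ⟩
    (y % N + o % N) % N  ≡⟨ %-distribˡ-+ y o N ⟨
    (y + o) % N          ∎
    where open ≡-Reasoning

  +-congˡ-≋ : ∀ o {x y} → x ≋ y → o + x ≋ o + y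
  +-congˡ-≋ o {x} {y} x≋y = begin
    (o + x) % N  ≡⟨ cong (_% N) (+-comm o x) ⟩
    (x + o) % N  ≡⟨ +-congʳ-≋ o {x} {y} x≋y ⟩
    (y + o) % N  ≡⟨ cong (_% N) (+-comm y o) ⟩
    (o + y) % N  ∎
    where open ≡-Reasoning

  +-cancelʳ-≋ : ∀ {x y} k → x + k ≋ y + k → x ≋ y
  +-cancelʳ-≋ {x} {y} k x+k≋y+k = begin
    x % N                ≡⟨ [m+kn]%n≡m%n x k N ⟨
    (x + k * N) % N      ≡⟨ cong (_% N) (shuffle x) ⟩
    (x + k + k * n) % N  ≡⟨ +-congʳ-≋ (k * n) {x + k} {y + k} x+k≋y+k ⟩
    (y + k + k * n) % N  ≡⟨ cong (_% N) (shuffle y) ⟨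
    (y + k * N) % N      ≡⟨ [m+kn]%n≡m%n y k N ⟩
    y % N                ∎
    where
    open ≡-Reasoning
    shuffle : ∀ z → z + k * N ≡ z + k + k * n
    shuffle z = trans (cong (z +_) (*-suc k n)) (sym (+-assoc z k (k * n)))

  +-cancelˡ-≋ : ∀ k {x y} → k + x ≋ k + y → x ≋ y
  +-cancelˡ-≋ k {x} {y} k+x≋k+y = +-cancelʳ-≋ {x} {y} k
    (trans (cong (_% N) (+-comm x k)) (trans k+x≋k+y (cong (_% N) (+-comm k y))))

  ≋⇒≡ : ∀ {x y} → x < N → y < N → x ≋ y → x ≡ y
  ≋⇒≡ x<N y<N x≋y = trans (sym (m<n⇒m%n≡m x<N)) (trans x≋y (m<n⇒m%n≡m y<N))

  k+x≉x : ∀ {k} x → 0 < k → k < N → ¬ (k + x ≋ x)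
  k+x≉x {k} x 0<k k<N k+x≋x =
    <⇒≢ 0<k (sym (≋⇒≡ k<N (s≤s z≤n) (+-cancelʳ-≋ {k} {0} x k+x≋x)))

module Permutations (n : ℕ) where

  open Residues n

  record IsPermutation (f : ℕ → ℕ) : Set where
    field
      bounded   : ∀ {x} → x < N → f x < N
      injective : ∀ {x y} → x < N → y < N → f x ≡ f y → x ≡ y

  open IsPermutation

  id-isPermutation : IsPermutation id
  id-isPermutation = record { bounded = id ; injective = λ _ _ → id }

  ∘-isPermutation : ∀ {g h} → IsPermutation g → IsPermutation h → IsPermutation (g ∘ h)
  ∘-isPermutation g-perm h-perm = record
    { bounded   = bounded g-perm ∘ bounded h-perm
    ; injective = λ x<N y<N →
        injective h-perm x<N y<N ∘ injective g-perm (bounded h-perm x<N) (bounded h-perm y<N)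
    }

  surjective : ∀ {f} → IsPermutation f → ∀ {y} → y < N → ∃[ x ] x < N × f x ≡ y
  surjective {f} f-perm {y} y<N = preimage (fin-injective⇒surjective f̂ f̂-injective (fromℕ< y<N))
    where
    f̂ : Fin N → Fin N
    f̂ i = fromℕ< (bounded f-perm (toℕ<n i))
    toℕ-f̂ : ∀ i → toℕ (f̂ i) ≡ f (toℕ i)
    toℕ-f̂ i = toℕ-fromℕ< (bounded f-perm (toℕ<n i))
    f̂-injective : Injective _≡_ _≡_ f̂
    f̂-injective {i} {j} f̂i≡f̂j = toℕ-injective (injective f-perm (toℕ<n i) (toℕ<n j)
      (trans (sym (toℕ-f̂ i)) (trans (cong toℕ f̂i≡f̂j) (toℕ-f̂ j))))
    preimage : ∃[ i ] f̂ i ≡ fromℕ< y<N → ∃[ x ] x < N × f x ≡ y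
    preimage (i , f̂i≡y) =
      toℕ i , toℕ<n i , trans (sym (toℕ-f̂ i)) (trans (cong toℕ f̂i≡y) (toℕ-fromℕ< y<N))

  distinct-images : ∀ (g h : ℕ → ℕ) → IsPermutation (g ∘ h) →
                    AllPairs (λ x y → g x ≢ g y) (applyUpTo h N)
  distinct-images g h gh-perm = AllPairs.applyUpTo⁺₁ h N
    (λ i<j j<N → <⇒≢ i<j ∘ injective gh-perm (<-trans i<j j<N) j<N)

  ↭-upTo : ∀ {f} → IsPermutation f → applyUpTo f N ↭ upTo N
  ↭-upTo {f} f-perm = ∼bag⇒↭ (unique∧set⇒bag
    (distinct-images id f f-perm) (distinct-images id id id-isPermutation) (mk⇔ ⊆ ⊇))
    where
    ⊆ : ∀ {z} → z ∈ applyUpTo f N → z ∈ upTo N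
    ⊆ z∈f with _ , i<N , refl ← ∈-applyUpTo⁻ f z∈f = ∈-upTo⁺ (bounded f-perm i<N)
    ⊇ : ∀ {z} → z ∈ upTo N → z ∈ applyUpTo f N
    ⊇ z∈N with _ , i<N , refl ← surjective f-perm (∈-upTo⁻ z∈N) = ∈-applyUpTo⁺ f i<N

  sign : (ℕ → ℕ) → Parity
  sign f = inversions (applyUpTo f N)

  sign-cong : ∀ {f g} → (∀ {x} → x < N → f x ≡ g x) → sign f ≡ sign g
  sign-cong f≗g = cong inversions (applyUpTo-cong N f≗g)

  sign-id : sign id ≡ 0ℙ
  sign-id = inversions-increasing (AllPairs.applyUpTo⁺₁ id N (λ i<j _ → i<j))

  -- Relabelling by g adds the discordances of g, which do not depend on the order of the list.
  sign-∘ : ∀ {g h} → IsPermutation g → IsPermutation h → sign (g ∘ h) ≡ sign g ⊕ sign h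
  sign-∘ {g} {h} g-perm h-perm = begin
    inversions (applyUpTo (g ∘ h) N)
      ≡⟨ cong inversions (map-applyUpTo h g N) ⟨
    inversions (map g (applyUpTo h N))
      ≡⟨ inversions-map g (distinct-images g h (∘-isPermutation g-perm h-perm)) ⟩
    sign h ⊕ discordances g (applyUpTo h N)
      ≡⟨ cong (sign h ⊕_) (discordances-↭ g (↭-upTo h-perm)) ⟩
    sign h ⊕ discordances g (upTo N)
      ≡⟨ cong (sign h ⊕_) sign-g ⟨
    sign h ⊕ sign g
      ≡⟨ ℙ.+-comm (sign h) (sign g) ⟩
    sign g ⊕ sign h ∎
    where
    open ≡-Reasoning
    sign-g : sign g ≡ discordances g (upTo N)
    sign-g = begin
      inversions (applyUpTo g N)                     ≡⟨ cong inversions (map-applyUpTo id g N) ⟨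
      inversions (map g (upTo N))                    ≡⟨ inversions-map g (distinct-images g id g-perm) ⟩
      inversions (upTo N) ⊕ discordances g (upTo N)  ≡⟨ cong (_⊕ discordances g (upTo N)) sign-id ⟩
      discordances g (upTo N)                        ∎

  translate : ℕ → ℕ → ℕ
  translate k x = (k + x) % N

  translate-isPermutation : ∀ k → IsPermutation (translate k)
  translate-isPermutation k = record
    { bounded   = λ {x} _ → m%n<n (k + x) N
    ; injective = λ {x} {y} x<N y<N → ≋⇒≡ x<N y<N ∘ +-cancelˡ-≋ k {x} {y}
    }

  -- translate 1 lists as 1, 2, …, n, 0: only the final 0 is out of order.
  sign-translate-1 : sign (translate 1) ≡ parity n
  sign-translate-1 = begin
    inversions (applyUpTo (translate 1) N)
      ≡⟨ cong inversions listing ⟩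
    inversions (applyUpTo suc n ∷ʳ 0)
      ≡⟨ inversions-∷ʳ (applyUpTo suc n) 0 ⟩
    inversions (applyUpTo suc n) ⊕ above 0 (applyUpTo suc n)
      ≡⟨ cong₂ _⊕_ increasing (above-zero id n) ⟩
    parity n ∎
    where
    open ≡-Reasoning
    listing : applyUpTo (translate 1) N ≡ applyUpTo suc n ∷ʳ 0
    listing = trans (sym (applyUpTo-∷ʳ (translate 1) n))
      (cong₂ _∷ʳ_ (applyUpTo-cong n (λ i<n → m<n⇒m%n≡m (s≤s i<n))) (n%n≡0 N))
    increasing : inversions (applyUpTo suc n) ≡ 0ℙ
    increasing = inversions-increasing (AllPairs.applyUpTo⁺₁ suc n (λ i<j _ → s≤s i<j))

  sign-translate : ∀ k → sign (translate k) ≡ parity (k * n)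
  sign-translate zero    = trans (sign-cong m<n⇒m%n≡m) sign-id
  sign-translate (suc k) = begin
    sign (translate (suc k))
      ≡⟨ sign-cong (λ {x} _ → sym (+-congˡ-≋ 1 {(k + x) % N} {k + x} (%-≋ (k + x)))) ⟩
    sign (translate 1 ∘ translate k)
      ≡⟨ sign-∘ (translate-isPermutation 1) (translate-isPermutation k) ⟩
    sign (translate 1) ⊕ sign (translate k)
      ≡⟨ cong₂ _⊕_ sign-translate-1 (sign-translate k) ⟩
    parity n ⊕ parity (k * n)
      ≡⟨ ℙ.+-homo-+ n (k * n) ⟨
    parity (suc k * n) ∎
    where open ≡-Reasoning

  module _ {σ τ w : ℕ → ℕ} (τ-perm : IsPermutation τ) (w-perm : IsPermutation w)
           (σw≡wτ : ∀ {j} → j < N → σ (w j) ≡ w (τ j)) where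

    conjugate-isPermutation : IsPermutation σ
    conjugate-isPermutation = record { bounded = σ-bounded ; injective = σ-injective }
      where
      σ-bounded : ∀ {x} → x < N → σ x < N
      σ-bounded x<N with i , i<N , refl ← surjective w-perm x<N =
        subst (_< N) (sym (σw≡wτ i<N)) (bounded w-perm (bounded τ-perm i<N))
      σ-injective : ∀ {x y} → x < N → y < N → σ x ≡ σ y → x ≡ y
      σ-injective x<N y<N σx≡σy
        with i , i<N , refl ← surjective w-perm x<N | j , j<N , refl ← surjective w-perm y<N =
        cong w (injective τ-perm i<N j<N (injective w-perm (bounded τ-perm i<N) (bounded τ-perm j<N)
          (trans (sym (σw≡wτ i<N)) (trans σx≡σy (σw≡wτ j<N)))))

    sign-conjugate : sign σ ≡ sign τ
    sign-conjugate = ℙ.+-cancelˡ-≡ (sign w) (sign σ) (sign τ) (begin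
      sign w ⊕ sign σ  ≡⟨ ℙ.+-comm (sign w) (sign σ) ⟩
      sign σ ⊕ sign w  ≡⟨ sign-∘ conjugate-isPermutation w-perm ⟨
      sign (σ ∘ w)     ≡⟨ sign-cong σw≡wτ ⟩
      sign (w ∘ τ)     ≡⟨ sign-∘ w-perm τ-perm ⟩
      sign w ⊕ sign τ  ∎)
      where open ≡-Reasoning

  record IsFullCycle (σ : ℕ → ℕ) : Set where
    field
      walk               : ℕ → ℕ
      walk-isPermutation : IsPermutation walk
      walk-step          : ∀ {j} → j < N → σ (walk j) ≡ walk (translate 1 j)

    isPermutation : IsPermutation σ
    isPermutation =
      conjugate-isPermutation {σ = σ} (translate-isPermutation 1) walk-isPermutation walk-step

    sign-fullCycle : sign σ ≡ parity n
    sign-fullCycle = trans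
      (sign-conjugate {σ = σ} (translate-isPermutation 1) walk-isPermutation walk-step)
      sign-translate-1

    closed⇒everything : (P : ℕ → Set) → P (walk 0) → (∀ {x} → x < N → P x → P (σ x)) →
                        ∀ {x} → x < N → P x
    closed⇒everything P P-start P-closed x<N
      with j , j<N , refl ← surjective walk-isPermutation x<N = P-walk j j<N
      where
      P-walk : ∀ j → j < N → P (walk j)
      P-walk zero    _   = P-start
      P-walk (suc j) j<N = subst P (trans (walk-step j<N′) (cong walk (m<n⇒m%n≡m j<N)))
        (P-closed (bounded walk-isPermutation j<N′) (P-walk j j<N′))
        where j<N′ = <-trans (n<1+n j) j<N

    no-2-cycle : 2 < N → ∀ {x} → x < N → σ (σ x) ≢ x
    no-2-cycle 2<N x<N σσx≡x
      with j , j<N , refl ← surjective walk-isPermutation x<N = k+x≉x j (s≤s z≤n) 2<N (begin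
        (2 + j) % N
          ≡⟨ +-congˡ-≋ 1 {(1 + j) % N} (%-≋ (1 + j)) ⟨
        translate 1 (translate 1 j)
          ≡⟨ injective walk-isPermutation (m%n<n (1 + translate 1 j) N) j<N two-steps ⟩
        j
          ≡⟨ m<n⇒m%n≡m j<N ⟨
        j % N ∎)
      where
      open ≡-Reasoning
      two-steps : walk (translate 1 (translate 1 j)) ≡ walk j
      two-steps = begin
        walk (translate 1 (translate 1 j))  ≡⟨ walk-step (m%n<n (1 + j) N) ⟨
        σ (walk (translate 1 j))            ≡⟨ cong σ (walk-step j<N) ⟨
        σ (σ (walk j))                      ≡⟨ σσx≡x ⟩
        walk j                              ∎

  cube≡id⇒isPermutation : ∀ {f} → (∀ {x} → x < N → f x < N) →
                          (∀ {x} → x < N → f (f (f x)) ≡ x) → IsPermutation f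
  cube≡id⇒isPermutation {f} f-bounded f³≡id = record
    { bounded   = f-bounded
    ; injective = λ x<N y<N fx≡fy →
        trans (sym (f³≡id x<N)) (trans (cong (f ∘ f) fx≡fy) (f³≡id y<N))
    }

  cube≡id⇒sign≡0ℙ : ∀ {f} → IsPermutation f → (∀ {x} → x < N → f (f (f x)) ≡ x) →
                    sign f ≡ 0ℙ
  cube≡id⇒sign≡0ℙ {f} f-perm f³≡id = begin
    sign f                      ≡⟨ ℙ.+-identityʳ (sign f) ⟨
    sign f ⊕ 0ℙ                 ≡⟨ cong (sign f ⊕_) (ℙ.p+p≡0ℙ (sign f)) ⟨
    sign f ⊕ (sign f ⊕ sign f)  ≡⟨ cong (sign f ⊕_) (sign-∘ f-perm f-perm) ⟨
    sign f ⊕ sign (f ∘ f)       ≡⟨ sign-∘ f-perm (∘-isPermutation f-perm f-perm) ⟨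
    sign (f ∘ f ∘ f)            ≡⟨ sign-cong f³≡id ⟩
    sign id                     ≡⟨ sign-id ⟩
    0ℙ                          ∎
    where open ≡-Reasoning

module Circulant (n : ℕ) {A : List ℕ}
  (v : Fin (suc n) → Fin (suc n)) (v-injective : Injective _≡_ _≡_ v)
  (v-arcs : ∀ i → CayArc (suc n) A (v i) (v (nextPos (suc n) i)))
  where

  open Residues n
  open Permutations n

  toℕ-mod : ∀ x → toℕ (x mod N) ≡ x % N
  toℕ-mod x = toℕ-fromℕ< (m%n<n x N)

  mod-toℕ : ∀ i → toℕ i mod N ≡ i
  mod-toℕ i = toℕ-injective (trans (toℕ-mod (toℕ i)) (m<n⇒m%n≡m (toℕ<n i)))

  mod-cong : ∀ {x y} → x ≋ y → x mod N ≡ y mod N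
  mod-cong {x} {y} x≋y = toℕ-injective (trans (toℕ-mod x) (trans x≋y (sym (toℕ-mod y))))

  arc-generator : Fin N → Fin (length A)
  arc-generator i = index (proj₁ (proj₂ (v-arcs i)))

  arc-head : ∀ i → toℕ (v (nextPos N i)) ≡ (toℕ (v i) + lookup A (arc-generator i)) % N
  arc-head i = trans (proj₂ (proj₂ (v-arcs i)))
    (cong (λ c → (toℕ (v i) + c) % N) (lookup-index (proj₁ (proj₂ (v-arcs i)))))

  position : ℕ → Fin N
  position x = proj₁ (fin-injective⇒surjective v v-injective (x mod N))

  v-position : ∀ x → v (position x) ≡ x mod N
  v-position x = proj₂ (fin-injective⇒surjective v v-injective (x mod N))

  position-cong : ∀ {x y} → x ≋ y → position x ≡ position y
  position-cong {x} {y} x≋y =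
    v-injective (trans (v-position x) (trans (mod-cong {x} {y} x≋y) (sym (v-position y))))

  generator : ℕ → Fin (length A)
  generator x = arc-generator (position x)

  generator-cong : ∀ {x y} → x ≋ y → generator x ≡ generator y
  generator-cong {x} {y} x≋y = cong arc-generator (position-cong {x} {y} x≋y)

  successor : ℕ → ℕ
  successor x = (x + lookup A (generator x)) % N

  successor-cong : ∀ {x y} → x ≋ y → successor x ≡ successor y
  successor-cong {x} {y} x≋y =
    trans (cong (λ g → (x + lookup A g) % N) (generator-cong {x} {y} x≋y))
          (+-congʳ-≋ (lookup A (generator y)) {x} {y} x≋y)

  walk : ℕ → ℕ
  walk j = toℕ (v (j mod N))

  walk-isPermutation : IsPermutation walk
  walk-isPermutation = record
    { bounded   = λ {j} _ → toℕ<n (v (j mod N))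
    ; injective = λ {i} {j} i<N j<N walk-i≡walk-j → ≋⇒≡ i<N j<N (trans (sym (toℕ-mod i))
        (trans (cong toℕ (v-injective (toℕ-injective walk-i≡walk-j))) (toℕ-mod j)))
    }

  walk-step : ∀ j → successor (walk j) ≡ walk (translate 1 j)
  walk-step j = begin
    (walk j + lookup A (arc-generator (position (walk j)))) % N
      ≡⟨ cong (λ i → (walk j + lookup A (arc-generator i)) % N) position-walk ⟩
    (walk j + lookup A (arc-generator (j mod N))) % N
      ≡⟨ arc-head (j mod N) ⟨
    toℕ (v (nextPos N (j mod N)))
      ≡⟨ cong (toℕ ∘ v) (mod-cong {suc (toℕ (j mod N))} {translate 1 j} next) ⟩
    walk (translate 1 j) ∎
    where
    open ≡-Reasoning
    position-walk : position (walk j) ≡ j mod N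
    position-walk = v-injective (trans (v-position (walk j)) (mod-toℕ (v (j mod N))))
    next : suc (toℕ (j mod N)) ≋ translate 1 j
    next = trans (cong (λ r → suc r % N) (toℕ-mod j))
                 (trans (+-congˡ-≋ 1 {j % N} (%-≋ j)) (sym (%-≋ (1 + j))))

  successor-isFullCycle : IsFullCycle successor
  successor-isFullCycle = record
    { walk = walk ; walk-isPermutation = walk-isPermutation ; walk-step = λ {j} _ → walk-step j }

  successor-injective : ∀ {x y} → successor x ≡ successor y → x ≋ y
  successor-injective {x} {y} σx≡σy =
    IsPermutation.injective (IsFullCycle.isPermutation successor-isFullCycle) (m%n<n x N) (m%n<n y N)
      (trans (successor-cong {x % N} {x} (%-≋ x))
             (trans σx≡σy (sym (successor-cong {y % N} {y} (%-≋ y)))))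

data Step : Set where
  s₀ s₂ s₃ : Step

long : Step → ℕ
long s₀ = 0
long s₂ = 1
long s₃ = 1

longest : Step → ℕ
longest s₀ = 0
longest s₂ = 0
longest s₃ = 1

long≤1 : ∀ s → long s ≤ 1
long≤1 s₀ = z≤n
long≤1 s₂ = s≤s z≤n
long≤1 s₃ = s≤s z≤n

longest≤1 : ∀ s → longest s ≤ 1
longest≤1 s₀ = z≤n
longest≤1 s₂ = z≤n
longest≤1 s₃ = s≤s z≤n

long≡1 : ∀ {s} → s ≢ s₀ → long s ≡ 1
long≡1 {s₀} s≢s₀ = contradiction refl s≢s₀
long≡1 {s₂} _    = refl
long≡1 {s₃} _    = refl

longest≡0 : ∀ {s} → s ≢ s₃ → longest s ≡ 0
longest≡0 {s₀} _    = refl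
longest≡0 {s₂} _    = refl
longest≡0 {s₃} s≢s₃ = contradiction refl s≢s₃

longest≡long : ∀ {s} → s ≢ s₂ → longest s ≡ long s
longest≡long {s₀} _    = refl
longest≡long {s₂} s≢s₂ = contradiction refl s≢s₂
longest≡long {s₃} _    = refl

cross : Step → Step → Step → ℕ
cross s t u = long u + (long t + longest s)

cross≤3 : ∀ s t u → cross s t u ≤ 3
cross≤3 s t u = +-mono-≤ (long≤1 u) (+-mono-≤ (long≤1 t) (longest≤1 s))

-- For the steps s, t, w at c, 1 + c, 3 + c: which of these vertices is the tail of the one arc
-- entering c + a + 3.
data Entry (s t w : Step) : Set where
  via-s₀ : w ≡ s₀ → t ≢ s₂ → s ≢ s₃ → Entry s t w
  via-s₂ : t ≡ s₂ → w ≢ s₀ → s ≢ s₃ → Entry s t w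
  via-s₃ : s ≡ s₃ → w ≢ s₀ → t ≢ s₂ → Entry s t w

cross-shift : ∀ {s t u w} → Entry s t w → cross t u w ≡ cross s t u
cross-shift {s} {t} {u} (via-s₀ refl t≢s₂ s≢s₃)
  rewrite longest≡long t≢s₂ | longest≡0 s≢s₃ = cong (long u +_) (sym (+-identityʳ (long t)))
cross-shift {s} {t} {u} {w} (via-s₂ refl w≢s₀ s≢s₃)
  rewrite long≡1 w≢s₀ | longest≡0 s≢s₃ = rearrange (long u)
  where
  rearrange : ∀ x → 1 + (x + 0) ≡ x + 1
  rearrange = solve-∀
cross-shift {s} {t} {u} {w} (via-s₃ refl w≢s₀ t≢s₂)
  rewrite long≡1 w≢s₀ | longest≡long t≢s₂ = rearrange (long u) (long t)
  where
  rearrange : ∀ x y → 1 + (x + y) ≡ x + (y + 1)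
  rearrange = solve-∀

cross≤1⇒short : ∀ s t u → cross s t u ≤ 1 → t ≡ s₀ ⊎ u ≡ s₀
cross≤1⇒short _ s₀ _  _        = inj₁ refl
cross≤1⇒short _ _  s₀ _        = inj₂ refl
cross≤1⇒short _ s₂ s₂ (s≤s ())
cross≤1⇒short _ s₂ s₃ (s≤s ())
cross≤1⇒short _ s₃ s₂ (s≤s ())
cross≤1⇒short _ s₃ s₃ (s≤s ())

long+long≤2 : ∀ t u → long u + (long t + 0) ≤ 2
long+long≤2 t u = +-mono-≤ (long≤1 u) (+-mono-≤ (long≤1 t) z≤n)

cross≡3⇒s₃ : ∀ s t u → cross s t u ≡ 3 → s ≡ s₃
cross≡3⇒s₃ s₀ t u cross≡3 = contradiction cross≡3 (<⇒≢ (s≤s (long+long≤2 t u)))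
cross≡3⇒s₃ s₂ t u cross≡3 = contradiction cross≡3 (<⇒≢ (s≤s (long+long≤2 t u)))
cross≡3⇒s₃ s₃ _ _ _       = refl

long+longest≡2⇒s₃ : ∀ t s → long t + longest s ≡ 2 → s ≡ s₃
long+longest≡2⇒s₃ _  s₃ _  = refl
long+longest≡2⇒s₃ s₀ s₀ ()
long+longest≡2⇒s₃ s₂ s₀ ()
long+longest≡2⇒s₃ s₃ s₀ ()
long+longest≡2⇒s₃ s₀ s₂ ()
long+longest≡2⇒s₃ s₂ s₂ ()
long+longest≡2⇒s₃ s₃ s₂ ()

long+2≡2⇒s₀ : ∀ u → long u + 2 ≡ 2 → u ≡ s₀
long+2≡2⇒s₀ s₀ _  = refl
long+2≡2⇒s₀ s₂ ()
long+2≡2⇒s₀ s₃ ()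

module NoHamiltonianCircuit
  (a n : ℕ) .{{_ : NonZero a}} (2a≡N : 2 * a ≡ suc n) (6∣a : 6 ∣ a)
  (v : Fin (suc n) → Fin (suc n)) (v-injective : Injective _≡_ _≡_ v)
  (v-arcs : ∀ i → CayArc (suc n) (a ∷ a + 2 ∷ a + 3 ∷ []) (v i) (v (nextPos (suc n) i)))
  where

  open Residues n
  open Permutations n
  open Circulant n v v-injective v-arcs
  open IsFullCycle successor-isFullCycle
    using (isPermutation; sign-fullCycle; closed⇒everything; no-2-cycle)

  a+a≡N : a + a ≡ N
  a+a≡N = trans (cong (a +_) (sym (+-identityʳ a))) 2a≡N

  6≤N : 6 ≤ N
  6≤N = ≤-trans (∣⇒≤ 6∣a) (subst (a ≤_) a+a≡N (m≤m+n a a))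

  1<N : 1 < N
  1<N = ≤-trans (s≤s (s≤s z≤n)) 6≤N

  2<N : 2 < N
  2<N = ≤-trans (s≤s (s≤s (s≤s z≤n))) 6≤N

  3<N : 3 < N
  3<N = ≤-trans (s≤s (s≤s (s≤s (s≤s z≤n)))) 6≤N

  2∣a : 2 ∣ a
  2∣a = ∣-trans (divides 3 refl) 6∣a

  3∣a : 3 ∣ a
  3∣a = ∣-trans (divides 2 refl) 6∣a

  parity-a : parity a ≡ 0ℙ
  parity-a with divides h a≡h*2 ← 2∣a =
    trans (cong parity a≡h*2) (trans (ℙ.*-homo-* h 2) (ℙ.*-zeroʳ (parity h)))

  parity-n : parity n ≡ 1ℙ
  parity-n = trans (sym (ℙ.suc-homo-⁻¹ n)) (cong _⁻¹ (begin
    parity N             ≡⟨ cong parity a+a≡N ⟨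
    parity (a + a)       ≡⟨ ℙ.+-homo-+ a a ⟩
    parity a ⊕ parity a  ≡⟨ ℙ.p+p≡0ℙ (parity a) ⟩
    0ℙ                   ∎))
    where open ≡-Reasoning

  jump : Step → ℕ
  jump s₀ = a
  jump s₂ = a + 2
  jump s₃ = a + 3

  toStep : Fin 3 → Step
  toStep zero             = s₀
  toStep (suc zero)       = s₂
  toStep (suc (suc zero)) = s₃

  step : ℕ → Step
  step x = toStep (generator x)

  step-cong : ∀ {x y} → x ≋ y → step x ≡ step y
  step-cong {x} {y} x≋y = cong toStep (generator-cong {x} {y} x≋y)

  step-pred : ∀ x → step (suc (x + n)) ≡ step x
  step-pred x = step-cong {suc (x + n)} {x} (suc[x+n]≋x x)

  successor-step : ∀ x → successor x ≡ (x + jump (step x)) % N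
  successor-step x = cong (λ c → (x + c) % N) (lookup-toStep (generator x))
    where
    lookup-toStep : ∀ i → lookup (a ∷ a + 2 ∷ a + 3 ∷ []) i ≡ jump (toStep i)
    lookup-toStep zero             = refl
    lookup-toStep (suc zero)       = refl
    lookup-toStep (suc (suc zero)) = refl

  source : Step → ℕ → ℕ
  source s₀ c = 3 + c
  source s₂ c = 1 + c
  source s₃ c = c

  source-jump : ∀ s c → source s c + jump s ≡ c + (a + 3)
  source-jump s₀ c = rearrange c a
    where
    rearrange : ∀ c a → 3 + c + a ≡ c + (a + 3)
    rearrange = solve-∀
  source-jump s₂ c = rearrange c a
    where
    rearrange : ∀ c a → 1 + c + (a + 2) ≡ c + (a + 3)
    rearrange = solve-∀
  source-jump s₃ c = refl

  source-injective : ∀ c {s t} → source s c ≋ source t c → s ≡ t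
  source-injective c {s₀} {s₀} _ = refl
  source-injective c {s₀} {s₂} e = ⊥-elim (k+x≉x {2} (1 + c) (s≤s z≤n) 2<N e)
  source-injective c {s₀} {s₃} e = ⊥-elim (k+x≉x {3} c (s≤s z≤n) 3<N e)
  source-injective c {s₂} {s₀} e = ⊥-elim (k+x≉x {2} (1 + c) (s≤s z≤n) 2<N (sym e))
  source-injective c {s₂} {s₂} _ = refl
  source-injective c {s₂} {s₃} e = ⊥-elim (k+x≉x {1} c (s≤s z≤n) 1<N e)
  source-injective c {s₃} {s₀} e = ⊥-elim (k+x≉x {3} c (s≤s z≤n) 3<N (sym e))
  source-injective c {s₃} {s₂} e = ⊥-elim (k+x≉x {1} c (s≤s z≤n) 1<N (sym e))
  source-injective c {s₃} {s₃} _ = refl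

  arrives : ∀ c {s} → step (source s c) ≡ s → successor (source s c) ≡ (c + (a + 3)) % N
  arrives c {s} step≡s = trans (successor-step (source s c))
    (trans (cong (λ t → (source s c + jump t) % N) step≡s) (cong (_% N) (source-jump s c)))

  entering : ∀ c → ∃[ s ] step (source s c) ≡ s
  entering c = from-preimage (surjective isPermutation (m%n<n (c + (a + 3)) N))
    where
    from-preimage : ∃[ x ] x < N × successor x ≡ (c + (a + 3)) % N → ∃[ s ] step (source s c) ≡ s
    from-preimage (x , _ , σx≡) = step x , sym (step-cong {x} {source (step x) c}
      (+-cancelʳ-≋ {x} {source (step x) c} (jump (step x))
        (trans (sym (successor-step x)) (trans σx≡ (cong (_% N) (sym (source-jump (step x) c)))))))

  entering-unique : ∀ c {s t} → step (source s c) ≡ s → step (source t c) ≡ t → s ≡ t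
  entering-unique c {s} {t} enters-s enters-t = source-injective c
    (successor-injective {source s c} {source t c} (trans (arrives c enters-s) (sym (arrives c enters-t))))

  -- The number of arcs x → x + jump (step x) − a with x ≤ c + 2 < x + jump (step x) − a.
  crossings : ℕ → ℕ
  crossings c = cross (step c) (step (1 + c)) (step (2 + c))

  -- Case splits on steps go through helper functions: a with-abstraction here makes Agda normalise
  -- step through the pigeonhole search behind position, which is hopelessly slow.
  entry : ∀ c → Entry (step c) (step (1 + c)) (step (3 + c))
  entry c = classify (entering c)
    where
    excludes : ∀ {s} → step (source s c) ≡ s → ∀ {t} → t ≢ s → step (source t c) ≢ t
    excludes enters t≢s enters′ = t≢s (entering-unique c enters′ enters)
    classify : ∃[ s ] step (source s c) ≡ s → Entry (step c) (step (1 + c)) (step (3 + c))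
    classify (s₀ , enters) = via-s₀ enters (excludes enters λ ()) (excludes enters λ ())
    classify (s₂ , enters) = via-s₂ enters (excludes enters λ ()) (excludes enters λ ())
    classify (s₃ , enters) = via-s₃ enters (excludes enters λ ()) (excludes enters λ ())

  crossings-constant : ∀ c → crossings c ≡ crossings 0
  crossings-constant zero    = refl
  crossings-constant (suc c) = trans (cross-shift (entry c)) (crossings-constant c)

  module _ (crossings≤1 : ∀ c → crossings c ≤ 1) where

    short-after-long : ∀ x → step x ≢ s₀ → step (1 + x) ≡ s₀
    short-after-long x step≢s₀ with cross≤1⇒short _ _ _ (crossings≤1 (x + n))
    ... | inj₁ e = contradiction (trans (sym (step-pred x)) e) step≢s₀
    ... | inj₂ e = trans (sym (step-pred (1 + x))) e

    no-two-short : ∀ y → step y ≡ s₀ → step (y + a) ≢ s₀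
    no-two-short y step-y step-y+a = no-2-cycle 2<N (m%n<n y N) (begin
      successor (successor (y % N))
        ≡⟨ cong successor (successor-cong {y % N} {y} (%-≋ y)) ⟩
      successor (successor y)
        ≡⟨ cong successor (trans (successor-step y) (cong (λ s → (y + jump s) % N) step-y)) ⟩
      successor ((y + a) % N)
        ≡⟨ successor-cong {(y + a) % N} {y + a} (%-≋ (y + a)) ⟩
      successor (y + a)
        ≡⟨ trans (successor-step (y + a)) (cong (λ s → (y + a + jump s) % N) step-y+a) ⟩
      (y + a + a) % N
        ≡⟨ cong (_% N) (trans (+-assoc y a a) (cong (y +_) a+a≡N)) ⟩
      (y + N) % N
        ≡⟨ +N-≋ y ⟩
      y % N ∎)
      where open ≡-Reasoning

    short-spreads : ∀ y → step y ≡ s₀ → step (2 + y) ≡ s₀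
    short-spreads y step-y = short-after-long (1 + y) (λ step-1+y →
      no-two-short (1 + y) step-1+y (short-after-long (y + a) (no-two-short y step-y)))

    crossings≤1⇒⊥ : ⊥
    crossings≤1⇒⊥ with divides h a≡h*2 ← 2∣a = start (cross≤1⇒short _ _ _ (crossings≤1 0))
      where
      iterate : ∀ {y} k → step y ≡ s₀ → step (k * 2 + y) ≡ s₀
      iterate zero    step-y = step-y
      iterate (suc k) step-y = short-spreads _ (iterate k step-y)
      refute : ∀ y → step y ≡ s₀ → ⊥
      refute y step-y = no-two-short y step-y
        (trans (cong step (trans (+-comm y a) (cong (_+ y) a≡h*2))) (iterate h step-y))
      start : step 1 ≡ s₀ ⊎ step 2 ≡ s₀ → ⊥
      start (inj₁ step-1) = refute 1 step-1
      start (inj₂ step-2) = refute 2 step-2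

  module _ (crossings≡3 : ∀ c → crossings c ≡ 3) where

    3∣N : 3 ∣ N
    3∣N = subst (3 ∣_) a+a≡N (∣m∣n⇒∣m+n 3∣a 3∣a)

    successor-mod-3 : ∀ x → successor x % 3 ≡ x % 3
    successor-mod-3 x = begin
      successor x % 3
        ≡⟨ cong (_% 3) (successor-step x) ⟩
      (x + jump (step x)) % N % 3
        ≡⟨ cong (λ s → (x + jump s) % N % 3)
                (cross≡3⇒s₃ (step x) (step (1 + x)) (step (2 + x)) (crossings≡3 x)) ⟩
      (x + (a + 3)) % N % 3
        ≡⟨ m∣n⇒o%n%m≡o%m 3 N (x + (a + 3)) 3∣N ⟩
      (x + (a + 3)) % 3
        ≡⟨ %-remove-+ʳ x (∣m∣n⇒∣m+n 3∣a ∣-refl) ⟩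
      x % 3 ∎
      where open ≡-Reasoning

    crossings≡3⇒⊥ : ⊥
    crossings≡3⇒⊥ = Residues.k+x≉x 2 {1} (walk 0) (s≤s z≤n) (s≤s (s≤s z≤n))
      (trans (sym (m∣n⇒o%n%m≡o%m 3 N (1 + walk 0) 3∣N))
        (closed⇒everything (λ x → x % 3 ≡ walk 0 % 3) refl
          (λ {x} _ x≡ → trans (successor-mod-3 x) x≡) (m%n<n (1 + walk 0) N)))

  -- The steps come in blocks s₂ and s₃ s₃ s₀, on which ρ is the identity and a 3-cycle.
  module _ (crossings≡2 : ∀ c → crossings c ≡ 2) where

    s₃s₃-before-s₀ : ∀ c → step (2 + c) ≡ s₀ → step c ≡ s₃ × step (1 + c) ≡ s₃
    s₃s₃-before-s₀ c step₂≡s₀ =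
      long+longest≡2⇒s₃ (step (1 + c)) (step c)
        (subst (λ u → cross (step c) (step (1 + c)) u ≡ 2) step₂≡s₀ (crossings≡2 c)) ,
      long+longest≡2⇒s₃ (step (3 + c)) (step (1 + c))
        (subst (λ t → cross (step (1 + c)) t (step (3 + c)) ≡ 2) step₂≡s₀ (crossings≡2 (1 + c)))

    s₀-after-s₃-long : ∀ c → step c ≡ s₃ → step (1 + c) ≢ s₀ → step (2 + c) ≡ s₀
    s₀-after-s₃-long c step₀≡s₃ step₁≢s₀ = long+2≡2⇒s₀ (step (2 + c)) (trans
      (cong₂ (λ p q → long (step (2 + c)) + (p + q))
             (sym (long≡1 step₁≢s₀)) (cong longest (sym step₀≡s₃)))
      (crossings≡2 c))

    -- n + n ≡ −2 (mod N)
    retreat : Step → ℕ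
    retreat s₀ = n + n
    retreat s₂ = 0
    retreat s₃ = 1

    ρ : ℕ → ℕ
    ρ x = (x + retreat (step x)) % N

    ρ-cong : ∀ {x y} → x ≋ y → ρ x ≡ ρ y
    ρ-cong {x} {y} x≋y = trans (cong (λ s → (x + retreat s) % N) (step-cong {x} {y} x≋y))
                               (+-congʳ-≋ (retreat (step y)) {x} {y} x≋y)

    ρ³-cong : ∀ {x y} → x ≋ y → ρ (ρ (ρ x)) ≡ ρ (ρ (ρ y))
    ρ³-cong {x} {y} x≋y = cong (ρ ∘ ρ) (ρ-cong {x} {y} x≋y)

    three-cycle : ∀ x y z → ρ x ≡ y % N → ρ y ≡ z % N → ρ z ≡ x % N →
                  ρ (ρ (ρ x)) ≡ x % N
    three-cycle x y z ρx ρy ρz = begin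
      ρ (ρ (ρ x))    ≡⟨ cong (ρ ∘ ρ) ρx ⟩
      ρ (ρ (y % N))  ≡⟨ cong ρ (ρ-cong {y % N} {y} (%-≋ y)) ⟩
      ρ (ρ y)        ≡⟨ cong ρ ρy ⟩
      ρ (z % N)      ≡⟨ ρ-cong {z % N} {z} (%-≋ z) ⟩
      ρ z            ≡⟨ ρz ⟩
      x % N          ∎
      where open ≡-Reasoning

    ρ-s₂ : ∀ {x} → step x ≡ s₂ → ρ x ≡ x % N
    ρ-s₂ {x} step≡s₂ =
      trans (cong (λ s → (x + retreat s) % N) step≡s₂) (cong (_% N) (+-identityʳ x))

    ρ-s₃ : ∀ {x} → step x ≡ s₃ → ρ x ≡ suc x % N
    ρ-s₃ {x} step≡s₃ =
      trans (cong (λ s → (x + retreat s) % N) step≡s₃) (cong (_% N) (+-comm x 1))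

    ρ-s₀ : ∀ {c} → step (2 + c) ≡ s₀ → ρ (2 + c) ≡ c % N
    ρ-s₀ {c} step≡s₀ = begin
      ρ (2 + c)              ≡⟨ cong (λ s → (2 + c + retreat s) % N) step≡s₀ ⟩
      (2 + c + (n + n)) % N  ≡⟨ cong (_% N) (rearrange c n) ⟩
      (c + N + N) % N        ≡⟨ +N-≋ (c + N) ⟩
      (c + N) % N            ≡⟨ +N-≋ c ⟩
      c % N                  ∎
      where
      open ≡-Reasoning
      rearrange : ∀ c n → 2 + c + (n + n) ≡ c + (1 + n) + (1 + n)
      rearrange = solve-∀

    block : ∀ c → step (2 + c) ≡ s₀ →
            ρ (ρ (ρ c)) ≡ c % N ×
            ρ (ρ (ρ (1 + c))) ≡ (1 + c) % N ×
            ρ (ρ (ρ (2 + c))) ≡ (2 + c) % N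
    block c step₂≡s₀ =
      three-cycle c (1 + c) (2 + c) ρ₀ ρ₁ ρ₂ ,
      three-cycle (1 + c) (2 + c) c ρ₁ ρ₂ ρ₀ ,
      three-cycle (2 + c) c (1 + c) ρ₂ ρ₀ ρ₁
      where
      ρ₀ : ρ c ≡ (1 + c) % N
      ρ₀ = ρ-s₃ {c} (proj₁ (s₃s₃-before-s₀ c step₂≡s₀))
      ρ₁ : ρ (1 + c) ≡ (2 + c) % N
      ρ₁ = ρ-s₃ {1 + c} (proj₂ (s₃s₃-before-s₀ c step₂≡s₀))
      ρ₂ : ρ (2 + c) ≡ c % N
      ρ₂ = ρ-s₀ {c} step₂≡s₀

    ρ³≡id : ∀ x → ρ (ρ (ρ x)) ≡ x % N
    ρ³≡id x = by-step (step x) refl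
      where
      by-step : ∀ s → step x ≡ s → ρ (ρ (ρ x)) ≡ x % N
      by-step s₂ step-x = three-cycle x x x ρ-x ρ-x ρ-x
        where
        ρ-x = ρ-s₂ {x} step-x
      by-step s₀ step-x = trans (ρ³-cong {x} {2 + c} (sym 2+c≋x))
                                (trans (proj₂ (proj₂ (block c step₂≡s₀))) 2+c≋x)
        where
        c = x + n + n
        2+c≋x : 2 + c ≋ x
        2+c≋x = trans (+-congˡ-≋ 1 {suc (x + n + n)} {x + n} (suc[x+n]≋x (x + n))) (suc[x+n]≋x x)
        step₂≡s₀ : step (2 + c) ≡ s₀
        step₂≡s₀ = trans (step-cong {2 + c} {x} 2+c≋x) step-x
      by-step s₃ step-x = by-next (step (1 + x)) refl
        where
        by-next : ∀ t → step (1 + x) ≡ t → ρ (ρ (ρ x)) ≡ x % N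
        by-next s₃ step-1+x =
          proj₁ (block x (s₀-after-s₃-long x step-x λ e → contradiction (trans (sym step-1+x) e) λ ()))
        by-next s₂ step-1+x =
          contradiction (trans (sym step-1+x) (proj₂ (s₃s₃-before-s₀ x step₂≡s₀))) λ ()
          where
          step₂≡s₀ : step (2 + x) ≡ s₀
          step₂≡s₀ = s₀-after-s₃-long x step-x λ e → contradiction (trans (sym step-1+x) e) λ ()
        by-next s₀ step-1+x = trans (ρ³-cong {x} {1 + c} (sym (suc[x+n]≋x x)))
                                    (trans (proj₁ (proj₂ (block c step₂≡s₀))) (suc[x+n]≋x x))
          where
          c = x + n
          step₂≡s₀ : step (2 + c) ≡ s₀
          step₂≡s₀ = trans (step-cong {2 + c} {1 + x} (suc[x+n]≋x (1 + x))) step-1+x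

    ρ³≡id-< : ∀ {x} → x < N → ρ (ρ (ρ x)) ≡ x
    ρ³≡id-< {x} x<N = trans (ρ³≡id x) (m<n⇒m%n≡m x<N)

    ρ-isPermutation : IsPermutation ρ
    ρ-isPermutation = cube≡id⇒isPermutation (λ {x} _ → m%n<n (x + retreat (step x)) N) ρ³≡id-<

    successor≡translate∘ρ : ∀ x → successor x ≡ translate (a + 2) (ρ x)
    successor≡translate∘ρ x = begin
      successor x
        ≡⟨ successor-step x ⟩
      (x + jump (step x)) % N
        ≡⟨ jump-retreat (step x) ⟩
      (a + 2 + (x + retreat (step x))) % N
        ≡⟨ +-congˡ-≋ (a + 2) {ρ x} {x + retreat (step x)} (%-≋ (x + retreat (step x))) ⟨
      translate (a + 2) (ρ x) ∎
      where
      open ≡-Reasoning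
      jump-retreat : ∀ s → x + jump s ≋ a + 2 + (x + retreat s)
      jump-retreat s₀ = sym (begin
        (a + 2 + (x + (n + n))) % N  ≡⟨ cong (_% N) (rearrange a x n) ⟩
        (x + a + N + N) % N          ≡⟨ +N-≋ (x + a + N) ⟩
        (x + a + N) % N              ≡⟨ +N-≋ (x + a) ⟩
        (x + a) % N                  ∎)
        where
        rearrange : ∀ a x n → a + 2 + (x + (n + n)) ≡ x + a + (1 + n) + (1 + n)
        rearrange = solve-∀
      jump-retreat s₂ = cong (_% N) (rearrange a x)
        where
        rearrange : ∀ a x → x + (a + 2) ≡ a + 2 + (x + 0)
        rearrange = solve-∀
      jump-retreat s₃ = cong (_% N) (rearrange a x)
        where
        rearrange : ∀ a x → x + (a + 3) ≡ a + 2 + (x + 1)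
        rearrange = solve-∀

    parity-[a+2]n : parity ((a + 2) * n) ≡ 0ℙ
    parity-[a+2]n = trans (ℙ.*-homo-* (a + 2) n)
      (cong (_⊛ parity n) (trans (ℙ.+-homo-+ a 2) (cong (_⊕ 0ℙ) parity-a)))

    crossings≡2⇒⊥ : ⊥
    crossings≡2⇒⊥ = contradiction (begin
      1ℙ
        ≡⟨ parity-n ⟨
      parity n
        ≡⟨ sign-fullCycle ⟨
      sign successor
        ≡⟨ sign-cong (λ {x} _ → successor≡translate∘ρ x) ⟩
      sign (translate (a + 2) ∘ ρ)
        ≡⟨ sign-∘ (translate-isPermutation (a + 2)) ρ-isPermutation ⟩
      sign (translate (a + 2)) ⊕ sign ρ
        ≡⟨ cong₂ _⊕_ (sign-translate (a + 2))
                     (cube≡id⇒sign≡0ℙ ρ-isPermutation ρ³≡id-<) ⟩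
      parity ((a + 2) * n) ⊕ 0ℙ
        ≡⟨ cong (_⊕ 0ℙ) parity-[a+2]n ⟩
      0ℙ ∎) λ ()
      where open ≡-Reasoning

  impossible : ⊥
  impossible = by-crossings (crossings 0) refl
    where
    constant : ∀ {k} → crossings 0 ≡ k → ∀ c → crossings c ≡ k
    constant F₀≡k c = trans (crossings-constant c) F₀≡k
    by-crossings : ∀ k → crossings 0 ≡ k → ⊥
    by-crossings 0 F₀≡0 = crossings≤1⇒⊥ (λ c → ≤-trans (≤-reflexive (constant F₀≡0 c)) z≤n)
    by-crossings 1 F₀≡1 = crossings≤1⇒⊥ (λ c → ≤-reflexive (constant F₀≡1 c))
    by-crossings 2 F₀≡2 = crossings≡2⇒⊥ (constant F₀≡2)
    by-crossings 3 F₀≡3 = crossings≡3⇒⊥ (constant F₀≡3)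
    by-crossings (suc (suc (suc (suc k)))) F₀≡4+k = contradiction
      (subst (_≤ 3) F₀≡4+k (cross≤3 (step 0) (step 1) (step 2))) λ { (s≤s (s≤s (s≤s ()))) }

theorem3p1 : (a : ℕ) → .{{_ : NonZero a}} → 6 ∣ a →
    ¬ HamiltonianCircuit (2 * a) {{m*n≢0 2 a}} (CayArc (2 * a) {{m*n≢0 2 a}} (a ∷ a + 2 ∷ a + 3 ∷ []))
theorem3p1 zero {{()}}
theorem3p1 a@(suc _) 6∣a (v , v-injective , v-arcs) =
  NoHamiltonianCircuit.impossible a _ refl 6∣a v v-injective v-arcs
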